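{- Let $c \geq 2$ and $s \geq 1$ be integers, and let $r$ be the smallest non-negative integer such that $\binom{r+c-1}{r} \geq s$. Then for every integer $t$ with $r \leq t \leq c^s - r$ there exists a $t \times s$ matrix $A$ with entries in $\{0,1,\ldots,c-1\}$ that has distinct rows and distinct column degrees. Furthermore, such an $A$, viewed as the bipartite adjacency matrix of a $c$-edge coloring of $K_{s,t}$, is an identity coloring except possibly when $A$ is square.
   Context: For a matrix with entries in $\{0,1,\ldots,c-1\}$, the degree of a column is the $c$-tuple $(x_0,x_1,\ldots,x_{c-1})$ where $x_i$ is the number of entries equal to $i$ in that column. The bipartite adjacency matrix of a coloring of the edges of $K_{s,t}$ (parts $X$ of size $s$, $Y$ of size $t$) by colors $\{0,\ldots,c-1\}$ is the $t \times s$ matrix whose $(i,j)$ entry is the color of the edge between the $i$-th vertex of $Y$ and the $j$-th vertex of $X$. The coloring is an identity coloring if its only color-preserving automorphism (graph automorphism $\phi$ with each edge $uv$ having the same color as $\phi(u)\phi(v)$) is the identity. -}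

module Defs where

open import Data.Nat using (ℕ; _≤_; _<_)
open import Data.Fin using (Fin; _≟_)
open import Data.Fin.Base using ()
open import Data.List using (length; filter; allFin)
open import Data.Sum using (_⊎_; inj₁; inj₂)
open import Data.Maybe using (Maybe; just; nothing)
open import Relation.Binary.PropositionalEquality using (_≡_; _≢_)
open import Relation.Nullary using (¬_)
open import Function.Definitions using (Bijective)

-- A t × s matrix with entries in {0,…,c-1}: A i j, i indexes rows (Y), j columns (X).
Matrix : ℕ → ℕ → ℕ → Set
Matrix c t s = Fin t → Fin s → Fin c

degree : ∀ {c t s} → Matrix c t s → Fin s → Fin c → ℕ
degree {t = t} A j k = length (filter (λ i → A i j ≟ k) (allFin t))

DistinctRows : ∀ {c t s} → Matrix c t s → Set
DistinctRows A = ∀ i i' → i ≢ i' → ¬ (∀ j → A i j ≡ A i' j)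

DistinctColumnDegrees : ∀ {c t s} → Matrix c t s → Set
DistinctColumnDegrees A = ∀ j j' → j ≢ j' → ¬ (∀ k → degree A j k ≡ degree A j' k)

Vertex : ℕ → ℕ → Set
Vertex s t = Fin s ⊎ Fin t

-- Edge colouring of K_{s,t} given by the bipartite adjacency matrix A:
-- just k  = u,v adjacent and edge uv has colour k;  nothing = not adjacent.
edgeColour : ∀ {c t s} → Matrix c t s → Vertex s t → Vertex s t → Maybe (Fin c)
edgeColour A (inj₁ j) (inj₂ i) = just (A i j)
edgeColour A (inj₂ i) (inj₁ j) = just (A i j)
edgeColour A (inj₁ _) (inj₁ _) = nothing
edgeColour A (inj₂ _) (inj₂ _) = nothing

ColourPreservingAut : ∀ {c t s} → Matrix c t s → (Vertex s t → Vertex s t) → Set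
ColourPreservingAut A φ =
  Bijective _≡_ _≡_ φ × (∀ u v → edgeColour A u v ≡ edgeColour A (φ u) (φ v))
  where open import Data.Product using (_×_)

IdentityColouring : ∀ {c t s} → Matrix c t s → Set
IdentityColouring {t = t} {s} A =
  ∀ (φ : Vertex s t → Vertex s t) → ColourPreservingAut A φ → ∀ v → φ v ≡ v

-- Think of a matrix as a set of t distinct rows in {0,…,c-1}^s.  A core of r rows
-- already has pairwise distinct column degrees: column j lists colour k exactly d_k times, in
-- sorted order, where d runs over s distinct weak compositions of r into c parts (there are
-- (r+c-1 choose r) ≥ s of them).  Since s > r by minimality of r, the compositions (r-j, j, 0, …),
-- j ≤ r, can be among them; they make the core rows distinct and give every core row the entries
-- 0 and 1 in columns 0 and r.  Rows that add the same vector to every column degree keep the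
-- degrees distinct: constant rows, and whole orbits of rows under the colour rotation x ↦ x + a
-- (mod c).  Avoiding the core and the constant rows, enough orbits remain to reach every size
-- r ≤ t < r + c·(1 + #orbits), and as all c^s rows together are balanced, the complement of a
-- solution is a solution; the two ranges cover [r, c^s - r].
-- For the second claim: if t ≠ s, a colour-preserving automorphism cannot swap the two sides, so it
-- permutes rows and columns separately.  Permuting rows preserves column degrees, so every column is
-- fixed; then every row keeps its entries, so every row is fixed.

module Submission where

open import Defs
open import Data.Nat using (ℕ; zero; suc; _+_; _*_; _^_; _∸_; _≤_; _<_; z≤n; s≤s; s≤s⁻¹; _⊓_; NonZero; _<?_)
open import Data.Nat.Combinatorics using (_C_; nCn≡1; nCk+nC[k+1]≡[n+1]C[k+1])
open import Data.Nat.Properties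
  using (≤-refl; ≤-reflexive; ≤-trans; ≤-antisym; ≤-<-trans; <⇒≤; ≮⇒≥; module ≤-Reasoning;
         +-comm; +-assoc; +-suc; +-identityʳ; +-cancelʳ-≡; +-cancelˡ-≤; +-cancelʳ-≤; +-cancelˡ-<;
         +-monoʳ-≤; +-monoˡ-≤; m≤m+n; *-comm; *-identityˡ; *-identityʳ; *-distribˡ-+; *-monoʳ-≤; *-monoˡ-≤;
         m+n∸m≡n; m+[n∸m]≡n; m∸n+n≡m; m∸[m∸n]≡n; m∸n≤m; n∸n≡0; ∸-+-assoc; m≤n⇒m⊓n≡m)
open import Data.Nat.DivMod
  using (_%_; _/_; _mod_; %-distribˡ-+; m%n%n≡m%n; [m+n]%n≡m%n; m<n⇒m%n≡m; m%n<n; m≡m%n+[m/n]*n; m<n*o⇒m/o<n)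
open import Data.Fin using (Fin; zero; suc; _≟_; toℕ; fromℕ<; inject≤)
open import Data.Fin.Properties using (toℕ-fromℕ<; toℕ-injective; toℕ<n; toℕ-inject≤; inject≤-injective; injective⇒≤)
open import Data.Vec using (Vec; []; _∷_; lookup; replicate; sum; _∷ʳ_; last)
import Data.Vec as Vec
open import Data.Vec.Properties
  using (∷-injective; ∷-injectiveˡ; ∷ʳ-injectiveˡ; last-∷ʳ; lookup∘tabulate; tabulate∘lookup; tabulate-cong;
         lookup-map; lookup-replicate; map-replicate; ≡-dec)
open import Data.List using (List; []; _∷_; [_]; _++_; length; filter; map; take; allFin; tabulate; applyUpTo; cartesianProductWith)
import Data.List as List
open import Data.List.Properties
  using (length-++; length-map; length-take; length-tabulate; length-applyUpTo; filter-++; map-++; map-∘;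
         map-cong; map-id; map-tabulate; map-applyUpTo; tabulate-lookup; lookup-applyUpTo; ++-identityʳ; ++-assoc)
open import Data.List.Relation.Unary.All using ([]; _∷_)
import Data.List.Relation.Unary.All as All
import Data.List.Relation.Unary.All.Properties as All
open import Data.List.Relation.Unary.AllPairs using ([]; _∷_)
open import Data.List.Relation.Unary.Any using (here)
open import Data.List.Relation.Unary.Unique.Propositional using (Unique)
import Data.List.Relation.Unary.Unique.Propositional.Properties as Unique
open import Data.List.Membership.Propositional using (_∈_)
open import Data.List.Membership.Propositional.Properties
  using (∈-filter⁺; ∈-filter⁻; ∈-allFin; ∈-map⁺; ∈-map⁻; ∈-lookup; ∈-++⁻; ∈-++⁺ˡ; ∈-++⁺ʳ;
         ∈-cartesianProductWith⁺; ∈-cartesianProductWith⁻; ∈-applyUpTo⁻)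
open import Data.List.Membership.Propositional.Properties.WithK using (unique∧set⇒bag)
open import Data.List.Relation.Binary.BagAndSetEquality using (∼bag⇒↭)
open import Data.List.Relation.Binary.Permutation.Propositional using (_↭_)
open import Data.List.Relation.Binary.Permutation.Propositional.Properties using (↭-length; filter-↭; map⁺)
open import Data.Maybe using (just; nothing)
open import Data.Maybe.Properties using (just-injective)
open import Data.Product using (Σ; ∃; _×_; _,_; proj₁; proj₂)
open import Data.Sum using (inj₁; inj₂)
open import Data.Sum.Properties using (inj₁-injective; inj₂-injective)
open import Function using (_∘_; _⇔_; mk⇔)
open import Relation.Binary.Definitions using (DecidableEquality)
open import Relation.Binary.PropositionalEquality
  using (_≡_; _≢_; _≗_; refl; sym; trans; cong; cong₂; subst; subst₂; module ≡-Reasoning)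
open import Relation.Nullary using (¬_; yes; no; contradiction)
open import Relation.Unary using (Pred; Decidable)
open import Relation.Unary.Properties using (∁?)

count : ∀ {a p} {A : Set a} {P : Pred A p} → Decidable P → List A → ℕ
count P? xs = length (filter P? xs)

module _ {a p} {A : Set a} {P : Pred A p} (P? : Decidable P) where

  count-++ : ∀ xs ys → count P? (xs ++ ys) ≡ count P? xs + count P? ys
  count-++ xs ys = trans (cong length (filter-++ P? xs ys)) (length-++ (filter P? xs))

  count-map : ∀ {b} {B : Set b} (f : B → A) xs → count P? (map f xs) ≡ count (P? ∘ f) xs
  count-map f [] = refl
  count-map f (x ∷ xs) with P? (f x)
  ... | yes _ = cong suc (count-map f xs)
  ... | no _ = count-map f xs

  count-↭ : ∀ {xs ys} → xs ↭ ys → count P? xs ≡ count P? ys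
  count-↭ p = ↭-length (filter-↭ P? p)

  count+count-∁≡length : ∀ xs → count P? xs + count (∁? P?) xs ≡ length xs
  count+count-∁≡length [] = refl
  count+count-∁≡length (x ∷ xs) with P? x
  ... | yes _ = cong suc (count+count-∁≡length xs)
  ... | no _ = trans (+-suc _ _) (cong suc (count+count-∁≡length xs))

  count-const-yes : ∀ {b} {B : Set b} {x} → P x → (ys : List B) → count P? (map (λ _ → x) ys) ≡ length ys
  count-const-yes px [] = refl
  count-const-yes {x = x} px (_ ∷ ys) with P? x
  ... | yes _ = cong suc (count-const-yes px ys)
  ... | no ¬px = contradiction px ¬px

  count-const-no : ∀ {b} {B : Set b} {x} → ¬ P x → (ys : List B) → count P? (map (λ _ → x) ys) ≡ 0
  count-const-no ¬px [] = refl
  count-const-no {x = x} ¬px (_ ∷ ys) with P? x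
  ... | yes px = contradiction px ¬px
  ... | no _ = count-const-no ¬px ys

unique-↭ : ∀ {a} {A : Set a} {xs ys : List A} → Unique xs → Unique ys → (∀ {x} → x ∈ xs ⇔ x ∈ ys) → xs ↭ ys
unique-↭ xs! ys! same = ∼bag⇒↭ (unique∧set⇒bag xs! ys! same)

map-↭-allFin : ∀ {n} {f : Fin n → Fin n} → (∀ {x y} → f x ≡ f y → x ≡ y) → (∀ y → ∃ λ x → f x ≡ y) →
               map f (allFin n) ↭ allFin n
map-↭-allFin {n} {f} f-injective f-surjective =
  unique-↭ (Unique.map⁺ f-injective (Unique.allFin⁺ n)) (Unique.allFin⁺ n) (mk⇔ (λ _ → ∈-allFin _) image)
  where
  image : ∀ {y} → y ∈ allFin n → y ∈ map f (allFin n)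
  image {y} _ with f-surjective y
  ... | x , refl = ∈-map⁺ f (∈-allFin x)

count-≟-allFin : ∀ {n} (k : Fin n) → count (_≟ k) (allFin n) ≡ 1
count-≟-allFin {n} k = ↭-length (unique-↭ (Unique.filter⁺ (_≟ k) (Unique.allFin⁺ n)) ([] ∷ []) (mk⇔ only-k is-k))
  where
  only-k : ∀ {x} → x ∈ filter (_≟ k) (allFin n) → x ∈ [ k ]
  only-k x∈ = here (proj₂ (∈-filter⁻ (_≟ k) {xs = allFin n} x∈))
  is-k : ∀ {x} → x ∈ [ k ] → x ∈ filter (_≟ k) (allFin n)
  is-k (here refl) = ∈-filter⁺ (_≟ k) (∈-allFin k) refl

module _ {a} {A : Set a} where

  lookup-injective : ∀ {xs : List A} → Unique xs → ∀ {i j} → List.lookup xs i ≡ List.lookup xs j → i ≡ j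
  lookup-injective {x ∷ xs} _ {zero} {zero} _ = refl
  lookup-injective {x ∷ xs} (x∉ ∷ _) {zero} {suc j} eq = contradiction eq (All.lookup x∉ (∈-lookup j))
  lookup-injective {x ∷ xs} (x∉ ∷ _) {suc i} {zero} eq = contradiction (sym eq) (All.lookup x∉ (∈-lookup i))
  lookup-injective {x ∷ xs} (_ ∷ xs!) {suc i} {suc j} eq = cong suc (lookup-injective xs! eq)

  lookup-ext : ∀ {n} {u v : Vec A n} → (∀ i → lookup u i ≡ lookup v i) → u ≡ v
  lookup-ext {u = u} {v} eq = trans (sym (tabulate∘lookup u)) (trans (tabulate-cong eq) (tabulate∘lookup v))

  module _ (_≟ᴬ_ : DecidableEquality A) where
    open import Data.List.Membership.DecPropositional _≟ᴬ_ using (_∈?_; _∉?_)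

    ++-filter-∉-↭ : ∀ {xs ys} → Unique xs → Unique ys → (∀ {x} → x ∈ xs → x ∈ ys) →
                    xs ++ filter (_∉? xs) ys ↭ ys
    ++-filter-∉-↭ {xs} {ys} xs! ys! xs⊆ys =
      unique-↭ (Unique.++⁺ xs! (Unique.filter⁺ (_∉? xs) ys!) disjoint) ys! (mk⇔ into from)
      where
      disjoint : ∀ {v} → ¬ (v ∈ xs × v ∈ filter (_∉? xs) ys)
      disjoint (v∈xs , v∈rest) = proj₂ (∈-filter⁻ (_∉? xs) {xs = ys} v∈rest) v∈xs
      into : ∀ {v} → v ∈ xs ++ filter (_∉? xs) ys → v ∈ ys
      into v∈ with ∈-++⁻ xs v∈
      ... | inj₁ v∈xs = xs⊆ys v∈xs
      ... | inj₂ v∈rest = proj₁ (∈-filter⁻ (_∉? xs) {xs = ys} v∈rest)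
      from : ∀ {v} → v ∈ ys → v ∈ xs ++ filter (_∉? xs) ys
      from {v} v∈ys with v ∈? xs
      ... | yes v∈xs = ∈-++⁺ˡ v∈xs
      ... | no v∉xs = ∈-++⁺ʳ xs (∈-filter⁺ (_∉? xs) v∈ys v∉xs)

    count-≟-≤1 : ∀ {xs} x → Unique xs → count (_≟ᴬ x) xs ≤ 1
    count-≟-≤1 {xs} x xs! = at-most-one (filter (_≟ᴬ x) xs) (Unique.filter⁺ (_≟ᴬ x) xs!)
      (All.tabulate (λ y∈ → proj₂ (∈-filter⁻ (_≟ᴬ x) {xs = xs} y∈)))
      where
      at-most-one : ∀ ys → Unique ys → All.All (_≡ x) ys → length ys ≤ 1
      at-most-one [] _ _ = z≤n
      at-most-one (_ ∷ []) _ _ = s≤s z≤n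
      at-most-one (_ ∷ _ ∷ _) ((y≢z ∷ _) ∷ _) (refl ∷ refl ∷ _) = contradiction refl y≢z

length-cartesianProductWith : ∀ {a b c} {A : Set a} {B : Set b} {C : Set c} (f : A → B → C) xs ys →
                              length (cartesianProductWith f xs ys) ≡ length xs * length ys
length-cartesianProductWith f [] ys = refl
length-cartesianProductWith f (x ∷ xs) ys =
  trans (length-++ (map (f x) ys)) (cong₂ _+_ (length-map (f x) ys) (length-cartesianProductWith f xs ys))

applyUpTo-cong : ∀ {a} {A : Set a} {f g : ℕ → A} → f ≗ g → ∀ n → applyUpTo f n ≡ applyUpTo g n
applyUpTo-cong f≗g zero = refl
applyUpTo-cong f≗g (suc n) = cong₂ _∷_ (f≗g 0) (applyUpTo-cong (f≗g ∘ suc) n)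

lookup-prefix : ∀ {a} {A : Set a} {L xs ys : List A} → L ≡ xs ++ ys →
                (i : Fin (length L)) (i<xs : toℕ i < length xs) → List.lookup L i ≡ List.lookup xs (fromℕ< i<xs)
lookup-prefix {xs = x ∷ xs} refl zero _ = refl
lookup-prefix {xs = x ∷ xs} refl (suc i) (s≤s i<xs) = lookup-prefix {xs = xs} refl i i<xs

column : ∀ {a} {A : Set a} {s} → List (Vec A s) → Fin s → List A
column R j = map (λ v → lookup v j) R

columnDegree : ∀ {c s} → List (Vec (Fin c) s) → Fin s → Fin c → ℕ
columnDegree R j k = count (_≟ k) (column R j)

DistinctDegrees : ∀ {c s} → List (Vec (Fin c) s) → Set
DistinctDegrees R = ∀ j j' → (∀ k → columnDegree R j k ≡ columnDegree R j' k) → j ≡ j'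

Balanced : ∀ {c s} → List (Vec (Fin c) s) → Set
Balanced R = ∀ j j' k → columnDegree R j k ≡ columnDegree R j' k

module _ {c s : ℕ} where

  columnDegree-++ : ∀ (R R' : List (Vec (Fin c) s)) j k →
                    columnDegree (R ++ R') j k ≡ columnDegree R j k + columnDegree R' j k
  columnDegree-++ R R' j k = trans (cong (count (_≟ k)) (map-++ _ R R')) (count-++ (_≟ k) (column R j) _)

  columnDegree-↭ : ∀ {R R' : List (Vec (Fin c) s)} → R ↭ R' → ∀ j k → columnDegree R j k ≡ columnDegree R' j k
  columnDegree-↭ R↭R' j k = count-↭ (_≟ k) (map⁺ _ R↭R')

  Balanced-++ : ∀ {R R' : List (Vec (Fin c) s)} → Balanced R → Balanced R' → Balanced (R ++ R')
  Balanced-++ {R} {R'} bal bal' j j' k = begin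
    columnDegree (R ++ R') j k                   ≡⟨ columnDegree-++ R R' j k ⟩
    columnDegree R j k + columnDegree R' j k     ≡⟨ cong₂ _+_ (bal j j' k) (bal' j j' k) ⟩
    columnDegree R j' k + columnDegree R' j' k   ≡⟨ columnDegree-++ R R' j' k ⟨
    columnDegree (R ++ R') j' k                  ∎
    where open ≡-Reasoning

  DistinctDegrees-++-Balanced : ∀ {R B : List (Vec (Fin c) s)} → DistinctDegrees R → Balanced B → DistinctDegrees (R ++ B)
  DistinctDegrees-++-Balanced {R} {B} distinct bal j j' same = distinct j j' λ k →
    +-cancelʳ-≡ (columnDegree B j k) _ _ (begin
      columnDegree R j k + columnDegree B j k     ≡⟨ columnDegree-++ R B j k ⟨
      columnDegree (R ++ B) j k                   ≡⟨ same k ⟩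
      columnDegree (R ++ B) j' k                  ≡⟨ columnDegree-++ R B j' k ⟩
      columnDegree R j' k + columnDegree B j' k   ≡⟨ cong (columnDegree R j' k +_) (bal j' j k) ⟩
      columnDegree R j' k + columnDegree B j k    ∎)
    where open ≡-Reasoning

  DistinctDegrees-complement : ∀ {R R' U : List (Vec (Fin c) s)} → Balanced U → R ++ R' ↭ U →
                               DistinctDegrees R → DistinctDegrees R'
  DistinctDegrees-complement {R} {R'} {U} bal R++R'↭U distinct j j' same = distinct j j' λ k →
    +-cancelʳ-≡ (columnDegree R' j k) _ _ (begin
      columnDegree R j k + columnDegree R' j k     ≡⟨ columnDegree-++ R R' j k ⟨
      columnDegree (R ++ R') j k                   ≡⟨ columnDegree-↭ R++R'↭U j k ⟩
      columnDegree U j k                           ≡⟨ bal j j' k ⟩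
      columnDegree U j' k                          ≡⟨ columnDegree-↭ R++R'↭U j' k ⟨
      columnDegree (R ++ R') j' k                  ≡⟨ columnDegree-++ R R' j' k ⟩
      columnDegree R j' k + columnDegree R' j' k   ≡⟨ cong (columnDegree R j' k +_) (same k) ⟨
      columnDegree R j' k + columnDegree R' j k    ∎)
    where open ≡-Reasoning

vectors : ∀ c n → List (Vec (Fin c) n)
vectors c zero = [ [] ]
vectors c (suc n) = cartesianProductWith _∷_ (allFin c) (vectors c n)

module _ {c : ℕ} where

  vectors-unique : ∀ n → Unique (vectors c n)
  vectors-unique zero = [] ∷ []
  vectors-unique (suc n) = Unique.cartesianProductWith⁺ _∷_ ∷-injective (Unique.allFin⁺ c) (vectors-unique n)

  ∈-vectors : ∀ {n} (v : Vec (Fin c) n) → v ∈ vectors c n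
  ∈-vectors [] = here refl
  ∈-vectors (a ∷ v) = ∈-cartesianProductWith⁺ _∷_ (∈-allFin a) (∈-vectors v)

  length-vectors : ∀ n → length (vectors c n) ≡ c ^ n
  length-vectors zero = refl
  length-vectors (suc n) = trans (length-cartesianProductWith _∷_ (allFin c) (vectors c n))
                                 (cong₂ _*_ (length-tabulate {n = c} (λ a → a)) (length-vectors n))

  columnDegree-∷-zero : ∀ {n} (L : List (Fin c)) (V : List (Vec (Fin c) n)) k →
                        columnDegree (cartesianProductWith _∷_ L V) zero k ≡ count (_≟ k) L * length V
  columnDegree-∷-zero [] V k = refl
  columnDegree-∷-zero (a ∷ L) V k with a ≟ k
  ... | yes a≡k = trans (columnDegree-++ (map (a ∷_) V) _ zero k)
    (cong₂ _+_ (trans (cong (count (_≟ k)) (sym (map-∘ V))) (count-const-yes (_≟ k) a≡k V)) (columnDegree-∷-zero L V k))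
  ... | no a≢k = trans (columnDegree-++ (map (a ∷_) V) _ zero k)
    (cong₂ _+_ (trans (cong (count (_≟ k)) (sym (map-∘ V))) (count-const-no (_≟ k) a≢k V)) (columnDegree-∷-zero L V k))

  columnDegree-∷-suc : ∀ {n} (L : List (Fin c)) (V : List (Vec (Fin c) n)) j k →
                       columnDegree (cartesianProductWith _∷_ L V) (suc j) k ≡ length L * columnDegree V j k
  columnDegree-∷-suc [] V j k = refl
  columnDegree-∷-suc (a ∷ L) V j k = trans (columnDegree-++ (map (a ∷_) V) _ (suc j) k)
    (cong₂ _+_ (cong (count (_≟ k)) (sym (map-∘ V))) (columnDegree-∷-suc L V j k))

  columnDegree-vectors : ∀ n j k → columnDegree (vectors c (suc n)) j k ≡ c ^ n
  columnDegree-vectors n zero k = trans (columnDegree-∷-zero (allFin c) (vectors c n) k)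
    (trans (cong₂ _*_ (count-≟-allFin k) (length-vectors n)) (*-identityˡ (c ^ n)))
  columnDegree-vectors (suc n) (suc j) k = trans (columnDegree-∷-suc (allFin c) (vectors c (suc n)) j k)
    (cong₂ _*_ (length-tabulate {n = c} (λ a → a)) (columnDegree-vectors n j k))

  Balanced-vectors : ∀ n → Balanced (vectors c (suc n))
  Balanced-vectors n j j' k = trans (columnDegree-vectors n j k) (sym (columnDegree-vectors n j' k))

[m%n+k]%n≡[m+k]%n : ∀ m k n .{{_ : NonZero n}} → (m % n + k) % n ≡ (m + k) % n
[m%n+k]%n≡[m+k]%n m k n = begin
  (m % n + k) % n            ≡⟨ %-distribˡ-+ (m % n) k n ⟩
  (m % n % n + k % n) % n    ≡⟨ cong (λ x → (x + k % n) % n) (m%n%n≡m%n m n) ⟩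
  (m % n + k % n) % n        ≡⟨ %-distribˡ-+ m k n ⟨
  (m + k) % n                ∎
  where open ≡-Reasoning

[[m+k]%n+[n∸k]]%n≡m%n : ∀ m {k} n .{{_ : NonZero n}} → k ≤ n → ((m + k) % n + (n ∸ k)) % n ≡ m % n
[[m+k]%n+[n∸k]]%n≡m%n m {k} n k≤n = begin
  ((m + k) % n + (n ∸ k)) % n   ≡⟨ [m%n+k]%n≡[m+k]%n (m + k) (n ∸ k) n ⟩
  (m + k + (n ∸ k)) % n         ≡⟨ cong (_% n) (trans (+-assoc m k (n ∸ k)) (cong (m +_) (m+[n∸m]≡n k≤n))) ⟩
  (m + n) % n                   ≡⟨ [m+n]%n≡m%n m n ⟩
  m % n                         ∎
  where open ≡-Reasoning

module _ {n : ℕ} where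

  infixl 6 _⊕_ _⊖_

  _⊕_ : Fin (suc n) → Fin (suc n) → Fin (suc n)
  x ⊕ y = (toℕ x + toℕ y) mod suc n

  _⊖_ : Fin (suc n) → Fin (suc n) → Fin (suc n)
  x ⊖ y = (toℕ x + (suc n ∸ toℕ y)) mod suc n

  toℕ-⊕ : ∀ x y → toℕ (x ⊕ y) ≡ (toℕ x + toℕ y) % suc n
  toℕ-⊕ x y = toℕ-fromℕ< _

  toℕ-⊖ : ∀ x y → toℕ (x ⊖ y) ≡ (toℕ x + (suc n ∸ toℕ y)) % suc n
  toℕ-⊖ x y = toℕ-fromℕ< _

  ⊕-comm : ∀ x y → x ⊕ y ≡ y ⊕ x
  ⊕-comm x y = cong (_mod suc n) (+-comm (toℕ x) (toℕ y))

  ⊕-identityˡ : ∀ x → zero ⊕ x ≡ x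
  ⊕-identityˡ x = toℕ-injective (trans (toℕ-⊕ zero x) (m<n⇒m%n≡m (toℕ<n x)))

  ⊕-identityʳ : ∀ x → x ⊕ zero ≡ x
  ⊕-identityʳ x = trans (⊕-comm x zero) (⊕-identityˡ x)

  [x⊕y]⊖y≡x : ∀ x y → x ⊕ y ⊖ y ≡ x
  [x⊕y]⊖y≡x x y = toℕ-injective (begin
    toℕ (x ⊕ y ⊖ y)
      ≡⟨ toℕ-⊖ (x ⊕ y) y ⟩
    (toℕ (x ⊕ y) + (suc n ∸ toℕ y)) % suc n
      ≡⟨ cong (λ m → (m + (suc n ∸ toℕ y)) % suc n) (toℕ-⊕ x y) ⟩
    ((toℕ x + toℕ y) % suc n + (suc n ∸ toℕ y)) % suc n
      ≡⟨ [[m+k]%n+[n∸k]]%n≡m%n (toℕ x) (suc n) (<⇒≤ (toℕ<n y)) ⟩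
    toℕ x % suc n
      ≡⟨ m<n⇒m%n≡m (toℕ<n x) ⟩
    toℕ x
      ∎)
    where open ≡-Reasoning

  [x⊖y]⊕y≡x : ∀ x y → x ⊖ y ⊕ y ≡ x
  [x⊖y]⊕y≡x x y = toℕ-injective (begin
    toℕ (x ⊖ y ⊕ y)
      ≡⟨ toℕ-⊕ (x ⊖ y) y ⟩
    (toℕ (x ⊖ y) + toℕ y) % suc n
      ≡⟨ cong (λ m → (m + toℕ y) % suc n) (toℕ-⊖ x y) ⟩
    (m % suc n + toℕ y) % suc n
      ≡⟨ cong (λ k → (m % suc n + k) % suc n) (m∸[m∸n]≡n (<⇒≤ (toℕ<n y))) ⟨
    (m % suc n + (suc n ∸ (suc n ∸ toℕ y))) % suc n
      ≡⟨ [[m+k]%n+[n∸k]]%n≡m%n (toℕ x) (suc n) (m∸n≤m (suc n) (toℕ y)) ⟩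
    toℕ x % suc n
      ≡⟨ m<n⇒m%n≡m (toℕ<n x) ⟩
    toℕ x
      ∎)
    where
    open ≡-Reasoning
    m = toℕ x + (suc n ∸ toℕ y)

  ⊕-cancelʳ : ∀ a {x y} → x ⊕ a ≡ y ⊕ a → x ≡ y
  ⊕-cancelʳ a {x} {y} eq = trans (sym ([x⊕y]⊖y≡x x a)) (trans (cong (_⊖ a) eq) ([x⊕y]⊖y≡x y a))

  ⊕-cancelˡ : ∀ a {x y} → a ⊕ x ≡ a ⊕ y → x ≡ y
  ⊕-cancelˡ a {x} {y} eq = ⊕-cancelʳ a (trans (⊕-comm x a) (trans eq (⊕-comm a y)))

  ⊕-solvableˡ : ∀ a k → ∃ λ x → a ⊕ x ≡ k
  ⊕-solvableˡ a k = k ⊖ a , trans (⊕-comm a (k ⊖ a)) ([x⊖y]⊕y≡x k a)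

  shift : ∀ {s} → Fin (suc n) → Vec (Fin (suc n)) s → Vec (Fin (suc n)) s
  shift a = Vec.map (_⊕ a)

  shift-injective : ∀ {s} a {u v : Vec (Fin (suc n)) s} → shift a u ≡ shift a v → u ≡ v
  shift-injective a {[]} {[]} _ = refl
  shift-injective a {x ∷ u} {y ∷ v} eq with ∷-injective eq
  ... | x⊕a≡y⊕a , eq' = cong₂ _∷_ (⊕-cancelʳ a x⊕a≡y⊕a) (shift-injective a eq')

  orbit : ∀ {s} → Vec (Fin (suc n)) s → List (Vec (Fin (suc n)) s)
  orbit v = map (λ a → shift a v) (allFin (suc n))

  Balanced-orbit : ∀ {s} (v : Vec (Fin (suc n)) s) → Balanced (orbit v)
  Balanced-orbit v j j' k = trans (degree-is-count j) (sym (degree-is-count j'))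
    where
    column-orbit : ∀ j → column (orbit v) j ↭ allFin (suc n)
    column-orbit j = subst (_↭ allFin (suc n))
      (trans (map-cong (λ a → sym (lookup-map j (_⊕ a) v)) (allFin (suc n))) (map-∘ (allFin (suc n))))
      (map-↭-allFin (⊕-cancelˡ (lookup v j)) (⊕-solvableˡ (lookup v j)))
    degree-is-count : ∀ j → columnDegree (orbit v) j k ≡ count (_≟ k) (allFin (suc n))
    degree-is-count j = count-↭ (_≟ k) (column-orbit j)

constants : ∀ {c} s → List (Fin c) → List (Vec (Fin c) s)
constants s = map (replicate s)

Balanced-constants : ∀ {c s} (as : List (Fin c)) → Balanced (constants s as)
Balanced-constants as j j' k = cong (count (_≟ k)) (trans (column-constants j) (sym (column-constants j')))
  where
  column-constants : ∀ j → column (constants _ as) j ≡ as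
  column-constants j = trans (sym (map-∘ as)) (trans (map-cong (lookup-replicate j) as) (map-id as))

orbits : ∀ {n s} → List (Vec (Fin (suc n)) s) → List (Vec (Fin (suc n)) (suc s))
orbits {n} ws = cartesianProductWith (λ w a → shift a (zero ∷ w)) ws (allFin (suc n))

module _ {n s : ℕ} where

  Balanced-orbits : (ws : List (Vec (Fin (suc n)) s)) → Balanced (orbits ws)
  Balanced-orbits [] j j' k = refl
  Balanced-orbits (w ∷ ws) = Balanced-++ {R = orbit (zero ∷ w)} (Balanced-orbit (zero ∷ w)) (Balanced-orbits ws)

  orbits-unique : ∀ {ws : List (Vec (Fin (suc n)) s)} → Unique ws → Unique (orbits ws)
  orbits-unique ws! = Unique.cartesianProductWith⁺ _ representative-injective ws! (Unique.allFin⁺ (suc n))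
    where
    representative-injective : ∀ {w w' a a'} → shift a (zero ∷ w) ≡ shift a' (zero ∷ w') → w ≡ w' × a ≡ a'
    representative-injective {w} {w'} {a} {a'} eq with ∷-injective eq
    ... | heads , tails with trans (sym (⊕-identityˡ a)) (trans heads (⊕-identityˡ a'))
    ... | refl = shift-injective a tails , refl

  length-orbits : (ws : List (Vec (Fin (suc n)) s)) → length (orbits ws) ≡ length ws * suc n
  length-orbits ws = trans (length-cartesianProductWith _ ws (allFin (suc n)))
                           (cong (length ws *_) (length-tabulate {n = suc n} (λ a → a)))

  ∈-orbits⁻ : ∀ (ws : List (Vec (Fin (suc n)) s)) {v} → v ∈ orbits ws →
              ∃ λ w → ∃ λ a → w ∈ ws × v ≡ shift a (zero ∷ w)
  ∈-orbits⁻ ws v∈ with ∈-cartesianProductWith⁻ _ ws (allFin (suc n)) v∈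
  ... | w , a , w∈ws , _ , eq = w , a , w∈ws , eq

RowSet : ℕ → ℕ → ℕ → Set
RowSet c t s = Σ (List (Vec (Fin c) s)) λ R → length R ≡ t × Unique R × DistinctDegrees R

Realisation : ℕ → ℕ → ℕ → Set
Realisation c t s = Σ (Matrix c t s) λ A → DistinctRows A × DistinctColumnDegrees A

realise : ∀ {c t s} → RowSet c t s → Realisation c t s
realise {c} {s = s} (R , refl , R! , distinct) = A , distinctRows , distinctColumns
  where
  A : Matrix c (length R) s
  A i j = lookup (List.lookup R i) j
  column-A : ∀ j → map (λ i → A i j) (allFin (length R)) ≡ column R j
  column-A j = begin
    map (λ i → A i j) (allFin (length R))               ≡⟨ map-tabulate (λ i → i) _ ⟩
    tabulate (λ i → A i j)                              ≡⟨ map-tabulate (List.lookup R) _ ⟨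
    map (λ v → lookup v j) (tabulate (List.lookup R))   ≡⟨ cong (map (λ v → lookup v j)) (tabulate-lookup R) ⟩
    column R j                                          ∎
    where open ≡-Reasoning
  degree-A : ∀ j k → degree A j k ≡ columnDegree R j k
  degree-A j k = trans (sym (count-map (_≟ k) (λ i → A i j) (allFin (length R)))) (cong (count (_≟ k)) (column-A j))
  distinctRows : DistinctRows A
  distinctRows i i' i≢i' same = i≢i' (lookup-injective R! (lookup-ext same))
  distinctColumns : DistinctColumnDegrees A
  distinctColumns j j' j≢j' same = j≢j' (distinct j j' λ k → trans (sym (degree-A j k)) (trans (same k) (degree-A j' k)))

complement : ∀ {c n t} → RowSet c t (suc n) → RowSet c (c ^ suc n ∸ t) (suc n)
complement {c} {n} (R , refl , R! , distinct) =
  R' , length-R' , Unique.filter⁺ (_∉? R) (vectors-unique (suc n)) ,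
  DistinctDegrees-complement {R = R} {R'} (Balanced-vectors n) partition distinct
  where
  _≟ᵛ_ : DecidableEquality (Vec (Fin c) (suc n))
  _≟ᵛ_ = ≡-dec _≟_
  open import Data.List.Membership.DecPropositional _≟ᵛ_ using (_∉?_)
  R' : List (Vec (Fin c) (suc n))
  R' = filter (_∉? R) (vectors c (suc n))
  partition : R ++ R' ↭ vectors c (suc n)
  partition = ++-filter-∉-↭ _≟ᵛ_ R! (vectors-unique (suc n)) (λ {v} _ → ∈-vectors v)
  length-R' : length R' ≡ c ^ suc n ∸ length R
  length-R' = begin
    length R'                           ≡⟨ m+n∸m≡n (length R) (length R') ⟨
    length R + length R' ∸ length R     ≡⟨ cong (_∸ length R) (length-++ R) ⟨
    length (R ++ R') ∸ length R         ≡⟨ cong (_∸ length R) (↭-length partition) ⟩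
    length (vectors c (suc n)) ∸ length R ≡⟨ cong (_∸ length R) (length-vectors {c} (suc n)) ⟩
    c ^ suc n ∸ length R                ∎
    where open ≡-Reasoning

incLast : ∀ {n} → Vec ℕ (suc n) → Vec ℕ (suc n)
incLast {zero} (x ∷ []) = suc x ∷ []
incLast {suc n} (x ∷ d) = x ∷ incLast d

sum-incLast : ∀ {n} (d : Vec ℕ (suc n)) → sum (incLast d) ≡ suc (sum d)
sum-incLast {zero} (x ∷ []) = refl
sum-incLast {suc n} (x ∷ d) = trans (cong (x +_) (sum-incLast d)) (+-suc x (sum d))

last-incLast : ∀ {n} (d : Vec ℕ (suc n)) → last (incLast d) ≡ suc (last d)
last-incLast {zero} (x ∷ []) = refl
last-incLast {suc n} (x ∷ d) = last-incLast d

incLast-injective : ∀ {n} {d e : Vec ℕ (suc n)} → incLast d ≡ incLast e → d ≡ e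
incLast-injective {zero} {x ∷ []} {y ∷ []} refl = refl
incLast-injective {suc n} {x ∷ d} {y ∷ e} eq with ∷-injective eq
... | refl , eq' = cong (x ∷_) (incLast-injective eq')

sum-∷ʳ-0 : ∀ {n} (d : Vec ℕ n) → sum (d ∷ʳ 0) ≡ sum d
sum-∷ʳ-0 [] = refl
sum-∷ʳ-0 (x ∷ d) = cong (x +_) (sum-∷ʳ-0 d)

replicate-∷ʳ : ∀ {a} {A : Set a} n (x : A) → replicate n x ∷ʳ x ≡ x ∷ replicate n x
replicate-∷ʳ zero x = refl
replicate-∷ʳ (suc n) x = cong (x ∷_) (replicate-∷ʳ n x)

compositions : (c' r : ℕ) → List (Vec ℕ (suc c'))
compositions zero r = [ r ∷ [] ]
compositions (suc c') zero = map (_∷ʳ 0) (compositions c' zero)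
compositions (suc c') (suc r) = map (_∷ʳ 0) (compositions c' (suc r)) ++ map incLast (compositions (suc c') r)

compositions-sum : ∀ c' r → All.All (λ d → sum d ≡ r) (compositions c' r)
compositions-sum zero r = +-identityʳ r ∷ []
compositions-sum (suc c') zero = All.map⁺ (All.map (λ {d} eq → trans (sum-∷ʳ-0 d) eq) (compositions-sum c' zero))
compositions-sum (suc c') (suc r) = All.++⁺
  (All.map⁺ (All.map (λ {d} eq → trans (sum-∷ʳ-0 d) eq) (compositions-sum c' (suc r))))
  (All.map⁺ (All.map (λ {d} eq → trans (sum-incLast d) (cong suc eq)) (compositions-sum (suc c') r)))

compositions-unique : ∀ c' r → Unique (compositions c' r)
compositions-unique zero r = [] ∷ []
compositions-unique (suc c') zero = Unique.map⁺ (∷ʳ-injectiveˡ _ _) (compositions-unique c' zero)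
compositions-unique (suc c') (suc r) =
  Unique.++⁺ (Unique.map⁺ (∷ʳ-injectiveˡ _ _) (compositions-unique c' (suc r)))
             (Unique.map⁺ incLast-injective (compositions-unique (suc c') r)) disjoint
  where
  disjoint : ∀ {v} → ¬ (v ∈ map (_∷ʳ 0) (compositions c' (suc r)) × v ∈ map incLast (compositions (suc c') r))
  disjoint (v∈₁ , v∈₂) with ∈-map⁻ (_∷ʳ 0) v∈₁ | ∈-map⁻ incLast v∈₂
  ... | d , _ , refl | e , _ , d∷ʳ0≡incLast-e =
    contradiction (trans (sym (last-∷ʳ 0 d)) (trans (cong last d∷ʳ0≡incLast-e) (last-incLast e))) (λ ())

length-compositions : ∀ c' r → length (compositions c' r) ≡ (r + c') C r
length-compositions zero r = trans (sym (nCn≡1 r)) (cong (_C r) (sym (+-identityʳ r)))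
length-compositions (suc c') zero = trans (length-map (_∷ʳ 0) (compositions c' zero)) (length-compositions c' zero)
length-compositions (suc c') (suc r) = begin
  length (map (_∷ʳ 0) (compositions c' (suc r)) ++ map incLast (compositions (suc c') r))
    ≡⟨ length-++ (map (_∷ʳ 0) (compositions c' (suc r))) ⟩
  length (map (_∷ʳ 0) (compositions c' (suc r))) + length (map incLast (compositions (suc c') r))
    ≡⟨ cong₂ _+_ (length-map (_∷ʳ 0) (compositions c' (suc r))) (length-map incLast (compositions (suc c') r)) ⟩
  length (compositions c' (suc r)) + length (compositions (suc c') r)
    ≡⟨ cong₂ _+_ (length-compositions c' (suc r)) (length-compositions (suc c') r) ⟩
  suc (r + c') C suc r + (r + suc c') C r
    ≡⟨ cong (λ m → m C suc r + (r + suc c') C r) (+-suc r c') ⟨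
  (r + suc c') C suc r + (r + suc c') C r
    ≡⟨ +-comm ((r + suc c') C suc r) _ ⟩
  (r + suc c') C r + (r + suc c') C suc r
    ≡⟨ nCk+nC[k+1]≡[n+1]C[k+1] (r + suc c') r ⟩
  (suc r + suc c') C suc r
    ∎
  where open ≡-Reasoning

twoColour : (c₂ r j : ℕ) → Vec ℕ (2 + c₂)
twoColour c₂ r j = (r ∸ j) ∷ j ∷ replicate c₂ 0

twoPart : (c₂ r : ℕ) → List (Vec ℕ (2 + c₂))
twoPart c₂ r = applyUpTo (twoColour c₂ r) (suc r)

compositions-two-colours : ∀ r → compositions 1 r ≡ twoPart 0 r
compositions-two-colours zero = refl
compositions-two-colours (suc r) = cong ((suc r ∷ 0 ∷ []) ∷_)
  (trans (cong (map incLast) (compositions-two-colours r)) (map-applyUpTo (twoColour 0 r) incLast (suc r)))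

compositions-∷ʳ-prefix : ∀ c' r → ∃ λ rest → compositions (suc c') r ≡ map (_∷ʳ 0) (compositions c' r) ++ rest
compositions-∷ʳ-prefix c' zero = [] , sym (++-identityʳ _)
compositions-∷ʳ-prefix c' (suc r) = _ , refl

compositions-twoPart : ∀ c₂ r → ∃ λ rest → compositions (suc c₂) r ≡ twoPart c₂ r ++ rest
compositions-twoPart zero r = [] , trans (compositions-two-colours r) (sym (++-identityʳ _))
compositions-twoPart (suc c₂) r with compositions-∷ʳ-prefix (suc c₂) r | compositions-twoPart c₂ r
... | more , eq | rest , eq' = map (_∷ʳ 0) rest ++ more , (begin
  compositions (suc (suc c₂)) r                                 ≡⟨ eq ⟩
  map (_∷ʳ 0) (compositions (suc c₂) r) ++ more                 ≡⟨ cong (λ L → map (_∷ʳ 0) L ++ more) eq' ⟩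
  map (_∷ʳ 0) (twoPart c₂ r ++ rest) ++ more                    ≡⟨ cong (_++ more) (map-++ (_∷ʳ 0) (twoPart c₂ r) rest) ⟩
  (map (_∷ʳ 0) (twoPart c₂ r) ++ map (_∷ʳ 0) rest) ++ more      ≡⟨ ++-assoc (map (_∷ʳ 0) (twoPart c₂ r)) _ more ⟩
  map (_∷ʳ 0) (twoPart c₂ r) ++ (map (_∷ʳ 0) rest ++ more)      ≡⟨ cong (_++ (map (_∷ʳ 0) rest ++ more)) extend ⟩
  twoPart (suc c₂) r ++ (map (_∷ʳ 0) rest ++ more)              ∎)
  where
  open ≡-Reasoning
  extend : map (_∷ʳ 0) (twoPart c₂ r) ≡ twoPart (suc c₂) r
  extend = trans (map-applyUpTo (twoColour c₂ r) (_∷ʳ 0) (suc r))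
                 (applyUpTo-cong (λ j → cong (λ z → (r ∸ j) ∷ j ∷ z) (replicate-∷ʳ c₂ 0)) (suc r))

length-compositions-≥ : ∀ c₂ r → suc r ≤ length (compositions (suc c₂) r)
length-compositions-≥ c₂ r with compositions-twoPart c₂ r
... | rest , eq = begin
  suc r                                ≡⟨ length-applyUpTo (twoColour c₂ r) (suc r) ⟨
  length (twoPart c₂ r)                ≤⟨ m≤m+n _ (length rest) ⟩
  length (twoPart c₂ r) + length rest  ≡⟨ length-++ (twoPart c₂ r) ⟨
  length (twoPart c₂ r ++ rest)        ≡⟨ cong length eq ⟨
  length (compositions (suc c₂) r)     ∎
  where open ≤-Reasoning

-- sortedEntry d i is the i-th entry of the column listing colour k exactly d_k times, in increasing order.
sortedEntry : ∀ {n} → Vec ℕ (suc n) → ℕ → Fin (suc n)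
sortedEntry {zero} _ _ = zero
sortedEntry {suc n} (zero ∷ d) i = suc (sortedEntry d i)
sortedEntry {suc n} (suc x ∷ d) zero = zero
sortedEntry {suc n} (suc x ∷ d) (suc i) = sortedEntry (x ∷ d) i

sortedEntry-< : ∀ {n x i} (d : Vec ℕ n) → i < x → sortedEntry (x ∷ d) i ≡ zero
sortedEntry-< {zero} d _ = refl
sortedEntry-< {suc n} {suc x} {zero} d _ = refl
sortedEntry-< {suc n} {suc x} {suc i} d (s≤s i<x) = sortedEntry-< d i<x

sortedEntry-+ : ∀ {n} x (d : Vec ℕ (suc n)) i → sortedEntry (x ∷ d) (x + i) ≡ suc (sortedEntry d i)
sortedEntry-+ zero d i = refl
sortedEntry-+ (suc x) d i = sortedEntry-+ x d i

sortedEntry-second : ∀ {n x y i} (d : Vec ℕ n) → x ≤ i → i < x + y → sortedEntry (x ∷ y ∷ d) i ≡ suc zero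
sortedEntry-second {x = x} {y} {i} d x≤i i<x+y = begin
  sortedEntry (x ∷ y ∷ d) i              ≡⟨ cong (sortedEntry (x ∷ y ∷ d)) (m+[n∸m]≡n x≤i) ⟨
  sortedEntry (x ∷ y ∷ d) (x + (i ∸ x))  ≡⟨ sortedEntry-+ x (y ∷ d) (i ∸ x) ⟩
  suc (sortedEntry (y ∷ d) (i ∸ x))      ≡⟨ cong suc (sortedEntry-< d i∸x<y) ⟩
  suc zero                               ∎
  where
  open ≡-Reasoning
  i∸x<y : i ∸ x < y
  i∸x<y = +-cancelˡ-< x _ _ (subst (_< x + y) (sym (m+[n∸m]≡n x≤i)) i<x+y)

count-≟zero-map-suc : ∀ {n} (xs : List (Fin n)) → count (_≟ zero) (map suc xs) ≡ 0
count-≟zero-map-suc [] = refl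
count-≟zero-map-suc (x ∷ xs) = count-≟zero-map-suc xs

count-≟suc-map-suc : ∀ {n} (k : Fin n) xs → count (_≟ suc k) (map suc xs) ≡ count (_≟ k) xs
count-≟suc-map-suc k [] = refl
count-≟suc-map-suc k (x ∷ xs) with x ≟ k
... | yes _ = cong suc (count-≟suc-map-suc k xs)
... | no _ = count-≟suc-map-suc k xs

count-≟zero-applyUpTo : ∀ m → count (_≟ zero) (applyUpTo (λ _ → zero {n = 0}) m) ≡ m
count-≟zero-applyUpTo zero = refl
count-≟zero-applyUpTo (suc m) = cong suc (count-≟zero-applyUpTo m)

count-sortedEntry : ∀ {n} (d : Vec ℕ (suc n)) k → count (_≟ k) (applyUpTo (sortedEntry d) (sum d)) ≡ lookup d k
count-sortedEntry {zero} (x ∷ []) zero =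
  trans (cong (λ m → count (_≟ zero) (applyUpTo _ m)) (+-identityʳ x)) (count-≟zero-applyUpTo x)
count-sortedEntry {suc n} (zero ∷ d) k = begin
  count (_≟ k) (applyUpTo (suc ∘ sortedEntry d) (sum d))       ≡⟨ cong (count (_≟ k)) (map-applyUpTo (sortedEntry d) suc (sum d)) ⟨
  count (_≟ k) (map suc (applyUpTo (sortedEntry d) (sum d)))   ≡⟨ after-zero k ⟩
  lookup (zero ∷ d) k                                           ∎
  where
  open ≡-Reasoning
  after-zero : ∀ k → count (_≟ k) (map suc (applyUpTo (sortedEntry d) (sum d))) ≡ lookup (zero ∷ d) k
  after-zero zero = count-≟zero-map-suc (applyUpTo (sortedEntry d) (sum d))
  after-zero (suc k) = trans (count-≟suc-map-suc k (applyUpTo (sortedEntry d) (sum d))) (count-sortedEntry d k)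
count-sortedEntry {suc n} (suc x ∷ d) zero = cong suc (count-sortedEntry (x ∷ d) zero)
count-sortedEntry {suc n} (suc x ∷ d) (suc k) = count-sortedEntry (x ∷ d) (suc k)

c*[c*p]≤[1+k]*c+[1+k]*c : ∀ c p k → 2 ≤ c → c * p ≤ p + suc k → c * (c * p) ≤ suc k * c + suc k * c
c*[c*p]≤[1+k]*c+[1+k]*c c p k 2≤c cp≤p+1+k = ≤-trans N≤cp+d (+-monoˡ-≤ d cp≤d)
  where
  d = suc k * c
  N≤cp+d : c * (c * p) ≤ c * p + d
  N≤cp+d = ≤-trans (*-monoʳ-≤ c cp≤p+1+k) (≤-reflexive (trans (*-distribˡ-+ c p (suc k)) (cong (c * p +_) (*-comm c (suc k)))))
  cp≤d : c * p ≤ d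
  cp≤d = +-cancelˡ-≤ (c * p) (c * p) d (begin
    c * p + c * p        ≡⟨ cong (c * p +_) (+-identityʳ (c * p)) ⟨
    2 * (c * p)          ≤⟨ *-monoˡ-≤ (c * p) 2≤c ⟩
    c * (c * p)          ≤⟨ N≤cp+d ⟩
    c * p + d            ∎)
    where open ≤-Reasoning

complement-in-range : ∀ {N d r t} → N ≤ d + d → 1 ≤ r → r ≤ t → t ≤ N ∸ r → ¬ (t ∸ r < d) → N ∸ r ∸ t < d
complement-in-range {N} {d} {r} {t} N≤d+d 1≤r r≤t t≤N∸r t∸r≮d = +-cancelʳ-≤ d (suc b) d (begin
  suc b + d            ≤⟨ +-monoʳ-≤ (suc b) (≮⇒≥ t∸r≮d) ⟩
  suc b + (t ∸ r)      ≡⟨ +-suc b (t ∸ r) ⟨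
  b + suc (t ∸ r)      ≤⟨ +-monoʳ-≤ b (+-monoˡ-≤ (t ∸ r) 1≤r) ⟩
  b + (r + (t ∸ r))    ≡⟨ cong (b +_) (m+[n∸m]≡n r≤t) ⟩
  b + t                ≡⟨ m∸n+n≡m t≤N∸r ⟩
  N ∸ r                ≤⟨ m∸n≤m N r ⟩
  N                    ≤⟨ N≤d+d ⟩
  d + d                ∎)
  where
  open ≤-Reasoning
  b = N ∸ r ∸ t

m∸[n+[m∸n∸o]]≡o : ∀ {N r t} → t ≤ N ∸ r → N ∸ (r + (N ∸ r ∸ t)) ≡ t
m∸[n+[m∸n∸o]]≡o {N} {r} {t} t≤N∸r = trans (sym (∸-+-assoc N r (N ∸ r ∸ t))) (m∸[m∸n]≡n t≤N∸r)

module Construction (c₂ s'' r₀ : ℕ) (r₀≤s'' : r₀ ≤ s'')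
                    (s≤#compositions : 2 + s'' ≤ length (compositions (suc c₂) (suc r₀))) where

  c s r : ℕ
  c = 2 + c₂
  s = 2 + s''
  r = suc r₀

  Row : Set
  Row = Vec (Fin c) s

  r<s : r < s
  r<s = s≤s (s≤s r₀≤s'')

  composition : Fin s → Vec ℕ c
  composition j = List.lookup (compositions (suc c₂) r) (inject≤ j s≤#compositions)

  composition-injective : ∀ {j j'} → composition j ≡ composition j' → j ≡ j'
  composition-injective eq = inject≤-injective _ _ _ _ (lookup-injective (compositions-unique (suc c₂) r) eq)

  sum-composition : ∀ j → sum (composition j) ≡ r
  sum-composition j = All.lookup (compositions-sum (suc c₂) r) (∈-lookup _)

  composition-twoColour : ∀ j → toℕ j ≤ r → composition j ≡ twoColour c₂ r (toℕ j)
  composition-twoColour j j≤r with compositions-twoPart c₂ r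
  ... | rest , eq = begin
    composition j                                       ≡⟨ lookup-prefix eq (inject≤ j s≤#compositions) in-prefix ⟩
    List.lookup (twoPart c₂ r) (fromℕ< in-prefix)       ≡⟨ lookup-applyUpTo (twoColour c₂ r) (suc r) _ ⟩
    twoColour c₂ r (toℕ (fromℕ< in-prefix))
                          ≡⟨ cong (twoColour c₂ r) (trans (toℕ-fromℕ< in-prefix) (toℕ-inject≤ j _)) ⟩
    twoColour c₂ r (toℕ j)                              ∎
    where
    open ≡-Reasoning
    in-prefix : toℕ (inject≤ j s≤#compositions) < length (twoPart c₂ r)
    in-prefix = subst₂ _<_ (sym (toℕ-inject≤ j _)) (sym (length-applyUpTo (twoColour c₂ r) (suc r))) (s≤s j≤r)

  coreRow : ℕ → Row
  coreRow i = Vec.tabulate (λ j → sortedEntry (composition j) i)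

  core : List Row
  core = applyUpTo coreRow r

  lookup-coreRow : ∀ i j → lookup (coreRow i) j ≡ sortedEntry (composition j) i
  lookup-coreRow i = lookup∘tabulate (λ j → sortedEntry (composition j) i)

  columnDegree-core : ∀ j k → columnDegree core j k ≡ lookup (composition j) k
  columnDegree-core j k = begin
    count (_≟ k) (map (λ v → lookup v j) (applyUpTo coreRow r))
      ≡⟨ cong (count (_≟ k)) (map-applyUpTo coreRow (λ v → lookup v j) r) ⟩
    count (_≟ k) (applyUpTo (λ i → lookup (coreRow i) j) r)
      ≡⟨ cong (count (_≟ k)) (applyUpTo-cong (λ i → lookup-coreRow i j) r) ⟩
    count (_≟ k) (applyUpTo (sortedEntry (composition j)) r)
      ≡⟨ cong (λ m → count (_≟ k) (applyUpTo (sortedEntry (composition j)) m)) (sum-composition j) ⟨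
    count (_≟ k) (applyUpTo (sortedEntry (composition j)) (sum (composition j)))
      ≡⟨ count-sortedEntry (composition j) k ⟩
    lookup (composition j) k
      ∎
    where open ≡-Reasoning

  DistinctDegrees-core : DistinctDegrees core
  DistinctDegrees-core j j' same = composition-injective (lookup-ext λ k →
    trans (sym (columnDegree-core j k)) (trans (same k) (columnDegree-core j' k)))

  coreRow-twoColour : ∀ {i} j → toℕ j ≤ r → lookup (coreRow i) j ≡ sortedEntry (twoColour c₂ r (toℕ j)) i
  coreRow-twoColour {i} j j≤r = trans (lookup-coreRow i j) (cong (λ d → sortedEntry d i) (composition-twoColour j j≤r))

  coreRow-below : ∀ {i} j → toℕ j ≤ r → i < r ∸ toℕ j → lookup (coreRow i) j ≡ zero
  coreRow-below j j≤r i< = trans (coreRow-twoColour j j≤r) (sortedEntry-< _ i<)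

  coreRow-above : ∀ {i} j → toℕ j ≤ r → r ∸ toℕ j ≤ i → i < r → lookup (coreRow i) j ≡ suc zero
  coreRow-above {i} j j≤r ≤i i<r =
    trans (coreRow-twoColour j j≤r) (sortedEntry-second _ ≤i (subst (i <_) (sym (m∸n+n≡m j≤r)) i<r))

  core-unique : Unique core
  core-unique = Unique.applyUpTo⁺₁ coreRow r separated
    where
    separated : ∀ {i i'} → i < i' → i' < r → coreRow i ≢ coreRow i'
    separated {i} {i'} i<i' i'<r eq = contradiction
      (trans (sym (coreRow-below j j≤r (subst (i <_) (sym boundary) i<i')))
        (trans (cong (λ v → lookup v j) eq) (coreRow-above j j≤r (≤-reflexive boundary) i'<r)))
      (λ ())
      where
      j<s : r ∸ i' < s
      j<s = ≤-<-trans (m∸n≤m r i') r<s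
      j : Fin s
      j = fromℕ< j<s
      j≤r : toℕ j ≤ r
      j≤r = subst (_≤ r) (sym (toℕ-fromℕ< j<s)) (m∸n≤m r i')
      boundary : r ∸ toℕ j ≡ i'
      boundary = trans (cong (r ∸_) (toℕ-fromℕ< j<s)) (m∸[m∸n]≡n (<⇒≤ i'<r))

  jw : Fin (suc s'')
  jw = fromℕ< (s≤s r₀≤s'')

  jr : Fin s
  jr = suc jw

  CoreLike : Row → Set
  CoreLike v = lookup v zero ≡ zero × lookup v jr ≡ suc zero

  core-CoreLike : ∀ {v} → v ∈ core → CoreLike v
  core-CoreLike v∈ with ∈-applyUpTo⁻ coreRow v∈
  ... | i , i<r , refl = coreRow-below zero z≤n i<r , coreRow-above jr jr≤r (subst (_≤ i) (sym r∸jr≡0) z≤n) i<r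
    where
    jr≡r : toℕ jr ≡ r
    jr≡r = cong suc (toℕ-fromℕ< (s≤s r₀≤s''))
    jr≤r : toℕ jr ≤ r
    jr≤r = ≤-reflexive jr≡r
    r∸jr≡0 : r ∸ toℕ jr ≡ 0
    r∸jr≡0 = trans (cong (r ∸_) jr≡r) (n∸n≡0 r)

  Word : Set
  Word = Vec (Fin c) (suc s'')

  zeroWord : Word
  zeroWord = replicate _ zero

  -- The orbit of zero ∷ w meets the core only if lookup w jw ≡ suc zero, and it consists of
  -- constant rows exactly when w ≡ zeroWord.
  GoodWord : Word → Set
  GoodWord w = lookup w jw ≢ suc zero × w ≢ zeroWord

  _≟ʷ_ : DecidableEquality Word
  _≟ʷ_ = ≡-dec _≟_

  meetsCore? : Decidable (λ (w : Word) → lookup w jw ≡ suc zero)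
  meetsCore? w = lookup w jw ≟ suc zero

  avoidsCore : List Word
  avoidsCore = filter (∁? meetsCore?) (vectors c (suc s''))

  goodWords : List Word
  goodWords = filter (∁? (_≟ʷ zeroWord)) avoidsCore

  goodWords-good : All.All GoodWord goodWords
  goodWords-good = All.tabulate λ {w} w∈ →
    let w∈avoidsCore , w≢0 = ∈-filter⁻ (∁? (_≟ʷ zeroWord)) {xs = avoidsCore} w∈
    in proj₂ (∈-filter⁻ (∁? meetsCore?) {xs = vectors c (suc s'')} w∈avoidsCore) , w≢0

  goodWords-unique : Unique goodWords
  goodWords-unique = Unique.filter⁺ _ (Unique.filter⁺ _ (vectors-unique (suc s'')))

  #goodWords : c * c ^ s'' ≤ c ^ s'' + suc (length goodWords)
  #goodWords = begin
    c * c ^ s''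
      ≡⟨ length-vectors (suc s'') ⟨
    length (vectors c (suc s''))
      ≡⟨ count+count-∁≡length meetsCore? (vectors c (suc s'')) ⟨
    count meetsCore? (vectors c (suc s'')) + length avoidsCore
      ≡⟨ cong (_+ length avoidsCore) meeting ⟩
    c ^ s'' + length avoidsCore
      ≡⟨ cong (c ^ s'' +_) (count+count-∁≡length (_≟ʷ zeroWord) avoidsCore) ⟨
    c ^ s'' + (count (_≟ʷ zeroWord) avoidsCore + length goodWords)
      ≤⟨ +-monoʳ-≤ (c ^ s'') (+-monoˡ-≤ (length goodWords) at-most-one-zeroWord) ⟩
    c ^ s'' + suc (length goodWords)
      ∎
    where
    open ≤-Reasoning
    at-most-one-zeroWord : count (_≟ʷ zeroWord) avoidsCore ≤ 1
    at-most-one-zeroWord = count-≟-≤1 _≟ʷ_ zeroWord (Unique.filter⁺ _ (vectors-unique (suc s'')))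
    meeting : count meetsCore? (vectors c (suc s'')) ≡ c ^ s''
    meeting = trans (sym (count-map (_≟ suc zero) (λ v → lookup v jw) (vectors c (suc s''))))
                    (columnDegree-vectors s'' jw (suc zero))

  D : ℕ
  D = suc (length goodWords) * c

  constantRows orbitRows padding : ℕ → List Row
  constantRows n = constants s (take (n % c) (allFin c))
  orbitRows n = orbits (take (n / c) goodWords)
  padding n = constantRows n ++ orbitRows n

  length-padding : ∀ n → n < D → length (padding n) ≡ n
  length-padding n n<D = begin
    length (padding n)                                                  ≡⟨ length-++ (constantRows n) ⟩
    length (constantRows n) + length (orbitRows n)
                                                                        ≡⟨ cong₂ _+_ #constants #orbits ⟩
    n % c + n / c * c                                                   ≡⟨ m≡m%n+[m/n]*n n c ⟨
    n                                                                   ∎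
    where
    open ≡-Reasoning
    #constants : length (constantRows n) ≡ n % c
    #constants = trans (length-map (replicate s) (take (n % c) (allFin c)))
      (trans (length-take (n % c) (allFin c))
        (trans (cong (n % c ⊓_) (length-tabulate {n = c} (λ a → a))) (m≤n⇒m⊓n≡m (<⇒≤ (m%n<n n c)))))
    #orbits : length (orbitRows n) ≡ n / c * c
    #orbits = trans (length-orbits (take (n / c) goodWords))
      (cong (_* c) (trans (length-take (n / c) goodWords) (m≤n⇒m⊓n≡m (s≤s⁻¹ (m<n*o⇒m/o<n n<D)))))

  padding-unique : ∀ n → Unique (padding n)
  padding-unique n = Unique.++⁺ (Unique.map⁺ ∷-injectiveˡ (Unique.take⁺ (n % c) (Unique.allFin⁺ c)))
                                (orbits-unique (Unique.take⁺ (n / c) goodWords-unique)) disjoint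
    where
    disjoint : ∀ {v} → ¬ (v ∈ constantRows n × v ∈ orbitRows n)
    disjoint (v∈₁ , v∈₂) with ∈-map⁻ (replicate s) v∈₁ | ∈-orbits⁻ (take (n / c) goodWords) v∈₂
    ... | b , _ , refl | w , a , w∈ , eq with ∷-injective eq
    ... | b≡0⊕a , tails = proj₂ (All.lookup (All.take⁺ (n / c) goodWords-good) w∈)
      (shift-injective a (trans (sym tails) (trans (cong (replicate _) b≡0⊕a) (sym (map-replicate (_⊕ a) zero _)))))

  padding-not-CoreLike : ∀ n {v} → v ∈ padding n → ¬ CoreLike v
  padding-not-CoreLike n {v} v∈ (col₀ , colr) with ∈-++⁻ (constantRows n) v∈
  ... | inj₁ v∈constants with ∈-map⁻ (replicate s) v∈constants
  ...   | b , _ , refl = contradiction (trans (sym col₀) (trans (sym (lookup-replicate jw b)) colr)) (λ ())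
  padding-not-CoreLike n {v} v∈ (col₀ , colr) | inj₂ v∈orbits with ∈-orbits⁻ (take (n / c) goodWords) v∈orbits
  ...   | w , a , w∈ , refl = proj₁ (All.lookup (All.take⁺ (n / c) goodWords-good) w∈)
          (trans (sym (⊕-identityʳ (lookup w jw))) (trans (cong (lookup w jw ⊕_) (sym a≡0)) colr'))
    where
    a≡0 : a ≡ zero
    a≡0 = trans (sym (⊕-identityˡ a)) col₀
    colr' : lookup w jw ⊕ a ≡ suc zero
    colr' = trans (sym (lookup-map jw (_⊕ a) w)) colr

  rowSet : ∀ n → n < D → RowSet c (r + n) s
  rowSet n n<D = core ++ padding n , length-rows , unique , distinct
    where
    length-rows : length (core ++ padding n) ≡ r + n
    length-rows = trans (length-++ core) (cong₂ _+_ (length-applyUpTo coreRow r) (length-padding n n<D))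
    unique : Unique (core ++ padding n)
    unique = Unique.++⁺ core-unique (padding-unique n)
      λ (v∈core , v∈padding) → padding-not-CoreLike n v∈padding (core-CoreLike v∈core)
    distinct : DistinctDegrees (core ++ padding n)
    distinct = DistinctDegrees-++-Balanced {R = core} DistinctDegrees-core
      (Balanced-++ {R = constantRows n} (Balanced-constants (take (n % c) (allFin c))) (Balanced-orbits (take (n / c) goodWords)))

  realisation : ∀ t → r ≤ t → t ≤ c ^ s ∸ r → Realisation c t s
  realisation t r≤t t≤ with t ∸ r <? D
  ... | yes small = realise (subst (λ t → RowSet c t s) (m+[n∸m]≡n r≤t) (rowSet (t ∸ r) small))
  ... | no large = realise (subst (λ t → RowSet c t s) (m∸[n+[m∸n∸o]]≡o {c ^ s} {r} t≤) (complement (rowSet _ opposite)))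
    where
    opposite : c ^ s ∸ r ∸ t < D
    opposite = complement-in-range (c*[c*p]≤[1+k]*c+[1+k]*c c (c ^ s'') (length goodWords) (s≤s (s≤s z≤n)) #goodWords)
                                   (s≤s z≤n) r≤t t≤ large

degree-cong : ∀ {c t s s'} {A : Matrix c t s} {B : Matrix c t s'} {j j'} →
              (∀ i → A i j ≡ B i j') → ∀ k → degree A j k ≡ degree B j' k
degree-cong {t = t} {A = A} {B} {j} {j'} same k = begin
  degree A j k                                  ≡⟨ count-map (_≟ k) (λ i → A i j) (allFin t) ⟨
  count (_≟ k) (map (λ i → A i j) (allFin t))   ≡⟨ cong (count (_≟ k)) (map-cong same (allFin t)) ⟩
  count (_≟ k) (map (λ i → B i j') (allFin t))  ≡⟨ count-map (_≟ k) (λ i → B i j') (allFin t) ⟩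
  degree B j' k                                 ∎
  where open ≡-Reasoning

degree-permuteRows : ∀ {c t s} (A : Matrix c t s) {τ : Fin t → Fin t} →
                     (∀ {i i'} → τ i ≡ τ i' → i ≡ i') → (∀ i' → ∃ λ i → τ i ≡ i') →
                     ∀ j k → degree (λ i → A (τ i)) j k ≡ degree A j k
degree-permuteRows {t = t} A {τ} τ-injective τ-surjective j k = begin
  degree (λ i → A (τ i)) j k                            ≡⟨ count-map (_≟ k) (λ i → A (τ i) j) (allFin t) ⟨
  count (_≟ k) (map (λ i → A (τ i) j) (allFin t))       ≡⟨ cong (count (_≟ k)) (map-∘ (allFin t)) ⟩
  count (_≟ k) (map (λ i → A i j) (map τ (allFin t)))   ≡⟨ count-↭ (_≟ k) (map⁺ _ (map-↭-allFin τ-injective τ-surjective)) ⟩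
  count (_≟ k) (map (λ i → A i j) (allFin t))           ≡⟨ count-map (_≟ k) (λ i → A i j) (allFin t) ⟩
  degree A j k                                          ∎
  where open ≡-Reasoning

module Automorphism {c t s} (A : Matrix c t s) {φ : Vertex s t → Vertex s t} (aut : ColourPreservingAut A φ) where

  private
    φ-injective : ∀ {u v} → φ u ≡ φ v → u ≡ v
    φ-injective = proj₁ (proj₁ aut)

    preserves : ∀ u v → edgeColour A u v ≡ edgeColour A (φ u) (φ v)
    preserves = proj₂ aut

    X-of-nothing : ∀ {j v} → edgeColour A (inj₁ j) v ≡ nothing → ∃ λ j' → v ≡ inj₁ j'
    X-of-nothing {v = inj₁ j'} _ = j' , refl

    Y-of-nothing : ∀ {i v} → edgeColour A (inj₂ i) v ≡ nothing → ∃ λ i' → v ≡ inj₂ i'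
    Y-of-nothing {v = inj₂ i'} _ = i' , refl

    Y-of-just : ∀ {j v k} → edgeColour A (inj₁ j) v ≡ just k → ∃ λ i → v ≡ inj₂ i
    Y-of-just {v = inj₂ i} _ = i , refl

    X-of-just : ∀ {i v k} → edgeColour A (inj₂ i) v ≡ just k → ∃ λ j → v ≡ inj₁ j
    X-of-just {v = inj₁ j} _ = j , refl

  SwapsSides : Set
  SwapsSides = (∀ j → ∃ λ i → φ (inj₁ j) ≡ inj₂ i) × (∀ i → ∃ λ j → φ (inj₂ i) ≡ inj₁ j)

  SwapsSides⇒≡ : SwapsSides → s ≡ t
  SwapsSides⇒≡ (X→Y , Y→X) = ≤-antisym (injective⇒≤ X→Y-injective) (injective⇒≤ Y→X-injective)
    where
    X→Y-injective : ∀ {j j'} → proj₁ (X→Y j) ≡ proj₁ (X→Y j') → j ≡ j'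
    X→Y-injective {j} {j'} eq = inj₁-injective (φ-injective
      (trans (proj₂ (X→Y j)) (trans (cong inj₂ eq) (sym (proj₂ (X→Y j'))))))
    Y→X-injective : ∀ {i i'} → proj₁ (Y→X i) ≡ proj₁ (Y→X i') → i ≡ i'
    Y→X-injective {i} {i'} eq = inj₂-injective (φ-injective
      (trans (proj₂ (Y→X i)) (trans (cong inj₁ eq) (sym (proj₂ (Y→X i'))))))

  X→Y⇒SwapsSides : ∀ {j₀ i₀} → φ (inj₁ j₀) ≡ inj₂ i₀ → SwapsSides
  X→Y⇒SwapsSides {j₀} eq =
    (λ j → Y-of-nothing (subst (λ u → edgeColour A u (φ (inj₁ j)) ≡ nothing) eq (sym (preserves (inj₁ j₀) (inj₁ j))))) ,
    (λ i → X-of-just (subst (λ u → edgeColour A u (φ (inj₂ i)) ≡ just (A i j₀)) eq (sym (preserves (inj₁ j₀) (inj₂ i)))))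

  Y→X⇒SwapsSides : ∀ {i₀ j₀} → φ (inj₂ i₀) ≡ inj₁ j₀ → SwapsSides
  Y→X⇒SwapsSides {i₀} eq =
    (λ j → Y-of-just (subst (λ u → edgeColour A u (φ (inj₁ j)) ≡ just (A i₀ j)) eq (sym (preserves (inj₂ i₀) (inj₁ j))))) ,
    (λ i → X-of-nothing (subst (λ u → edgeColour A u (φ (inj₂ i)) ≡ nothing) eq (sym (preserves (inj₂ i₀) (inj₂ i)))))

  module _ (t≢s : t ≢ s) where

    preserves-X : ∀ j → ∃ λ j' → φ (inj₁ j) ≡ inj₁ j'
    preserves-X j with φ (inj₁ j) in eq
    ... | inj₁ j' = j' , refl
    ... | inj₂ _ = contradiction (sym (SwapsSides⇒≡ (X→Y⇒SwapsSides eq))) t≢s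

    preserves-Y : ∀ i → ∃ λ i' → φ (inj₂ i) ≡ inj₂ i'
    preserves-Y i with φ (inj₂ i) in eq
    ... | inj₂ i' = i' , refl
    ... | inj₁ _ = contradiction (sym (SwapsSides⇒≡ (Y→X⇒SwapsSides eq))) t≢s

    σ : Fin s → Fin s
    σ j = proj₁ (preserves-X j)

    τ : Fin t → Fin t
    τ i = proj₁ (preserves-Y i)

    A≡A∘τσ : ∀ i j → A i j ≡ A (τ i) (σ j)
    A≡A∘τσ i j = just-injective
      (trans (preserves (inj₁ j) (inj₂ i)) (cong₂ (edgeColour A) (proj₂ (preserves-X j)) (proj₂ (preserves-Y i))))

    τ-injective : ∀ {i i'} → τ i ≡ τ i' → i ≡ i'
    τ-injective {i} {i'} eq = inj₂-injective (φ-injective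
      (trans (proj₂ (preserves-Y i)) (trans (cong inj₂ eq) (sym (proj₂ (preserves-Y i'))))))

    τ-surjective : ∀ i' → ∃ λ i → τ i ≡ i'
    τ-surjective i' with proj₂ (proj₁ aut) (inj₂ i')
    ... | inj₁ j , hit = contradiction (trans (sym (proj₂ (preserves-X j))) (hit refl)) λ ()
    ... | inj₂ i , hit = i , inj₂-injective (trans (sym (proj₂ (preserves-Y i))) (hit refl))

    fixes-all : DistinctRows A → DistinctColumnDegrees A → ∀ v → φ v ≡ v
    fixes-all distinctRows distinctDegrees = fixes
      where
      σ-fixes : ∀ j → σ j ≡ j
      σ-fixes j with σ j ≟ j
      ... | yes σj≡j = σj≡j
      ... | no σj≢j = contradiction (λ k → sym (trans (degree-cong {A = A} {B = λ i → A (τ i)} (λ i → A≡A∘τσ i j) k)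
                                                     (degree-permuteRows A τ-injective τ-surjective (σ j) k)))
                                    (distinctDegrees (σ j) j σj≢j)

      τ-fixes : ∀ i → τ i ≡ i
      τ-fixes i with τ i ≟ i
      ... | yes τi≡i = τi≡i
      ... | no τi≢i = contradiction (λ j → trans (cong (A (τ i)) (sym (σ-fixes j))) (sym (A≡A∘τσ i j)))
                                    (distinctRows (τ i) i τi≢i)

      fixes : ∀ v → φ v ≡ v
      fixes (inj₁ j) = trans (proj₂ (preserves-X j)) (cong inj₁ (σ-fixes j))
      fixes (inj₂ i) = trans (proj₂ (preserves-Y i)) (cong inj₂ (τ-fixes i))

identityColouring : ∀ {c t s} (A : Matrix c t s) → DistinctRows A → DistinctColumnDegrees A → t ≢ s → IdentityColouring A
identityColouring A distinctRows distinctDegrees t≢s φ aut = Automorphism.fixes-all A aut t≢s distinctRows distinctDegrees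

singleColumn : ∀ {c t} → t ≤ c → Realisation c t 1
singleColumn {c} {t} t≤c = (λ i _ → inject≤ i t≤c) , distinctRows , distinctColumns
  where
  distinctRows : DistinctRows {c} {t} {1} (λ i _ → inject≤ i t≤c)
  distinctRows i i' i≢i' same = i≢i' (inject≤-injective t≤c t≤c i i' (same zero))
  distinctColumns : DistinctColumnDegrees {c} {t} {1} (λ i _ → inject≤ i t≤c)
  distinctColumns zero zero 0≢0 _ = 0≢0 refl

realisation-fromCompositions : ∀ c₂ s r₀ → 2 + r₀ ≤ s → s ≤ length (compositions (suc c₂) (suc r₀)) →
                               ∀ t → suc r₀ ≤ t → t ≤ (2 + c₂) ^ s ∸ suc r₀ → Realisation (2 + c₂) t s
realisation-fromCompositions c₂ (suc (suc s'')) r₀ (s≤s (s≤s r₀≤s'')) s≤#compositions =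
  Construction.realisation c₂ s'' r₀ r₀≤s'' s≤#compositions

realisation : (c s r : ℕ) → 2 ≤ c → 1 ≤ s
  → s ≤ (r + (c ∸ 1)) C r
  → (∀ r' → r' < r → (r' + (c ∸ 1)) C r' < s)
  → ∀ t → r ≤ t → t ≤ c ^ s ∸ r → Realisation c t s
realisation c (suc zero) zero _ _ _ _ t _ t≤c*1 = singleColumn (subst (t ≤_) (*-identityʳ c) t≤c*1)
realisation c (suc (suc _)) zero _ _ (s≤s ()) _
realisation (suc (suc c₂)) s (suc r₀) (s≤s (s≤s z≤n)) _ s≤C minimal =
  realisation-fromCompositions c₂ s r₀ r<s (subst (s ≤_) (sym (length-compositions (suc c₂) (suc r₀))) s≤C)
  where
  r<s : 2 + r₀ ≤ s
  r<s = ≤-trans (s≤s (subst (suc r₀ ≤_) (length-compositions (suc c₂) r₀) (length-compositions-≥ c₂ r₀))) (minimal r₀ ≤-refl)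

lemma5 : (c s r : ℕ) → 2 ≤ c → 1 ≤ s
    → s ≤ (r + (c ∸ 1)) C r
    → (∀ r' → r' < r → (r' + (c ∸ 1)) C r' < s)
    → (t : ℕ) → r ≤ t → t ≤ c ^ s ∸ r
    → Σ (Matrix c t s) (λ A → DistinctRows A × DistinctColumnDegrees A)
      × (∀ (A : Matrix c t s) → DistinctRows A → DistinctColumnDegrees A
           → t ≢ s → IdentityColouring A)
lemma5 c s r 2≤c 1≤s s≤C minimal t r≤t t≤ = realisation c s r 2≤c 1≤s s≤C minimal t r≤t t≤ , identityColouring
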